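{- Let $U=(U_{i,j})_{i,j\ge 0}$ be the infinite integer matrix, with rows and columns indexed by non-negative integers, defined by $U_{i,j}=1$ if the binomial coefficient $\binom{j}{i}$ is odd and $U_{i,j}=0$ if it is even (with $\binom{j}{i}=0$ for $i>j$). For integers $n,m\ge 0$ let $U_m(n)=U_{[0:n),[m:m+n)}$ denote the $n\times n$ sub-matrix of $U$ formed by the rows indexed $0,1,\dots,n-1$ and the columns indexed $m,m+1,\dots,m+n-1$. Then for all $n,m\ge 0$, the determinant of $U_m(n)$, computed in $\mathbb{Z}$, equals $1$ or $-1$.
   Context: For integers $a\le b$, $[a:b)=\{k\in\mathbb{Z}: a\le k<b\}$. For index sets $I,J\subseteq\mathbb{Z}_{\ge 0}$, $U_{I,J}$ is the sub-matrix of $U$ with rows indexed by $I$ and columns indexed by $J$ (in increasing order). The empty ($n=0$) determinant is $1$. -}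

module Defs where

open import Data.Nat using (ℕ; zero; suc; _+_; _%_)
open import Data.Nat.Combinatorics using (_C_)
open import Data.Fin using (Fin; zero; suc; toℕ; punchIn)
open import Data.Integer as ℤ using (ℤ; +_; -_)

signedSum : (k : ℕ) → (Fin k → ℤ) → ℤ
signedSum zero    f = + 0
signedSum (suc k) f = f zero ℤ.- signedSum k (λ j → f (suc j))

det : (n : ℕ) → (Fin n → Fin n → ℤ) → ℤ
det zero    M = + 1
det (suc n) M =
  signedSum (suc n) (λ j → M zero j ℤ.* det n (λ r c → M (suc r) (punchIn j c)))

U : ℕ → ℕ → ℤ
U i j = + ((j C i) % 2)

Usub : (m n : ℕ) → Fin n → Fin n → ℤ
Usub m n r c = U (toℕ r) (m + toℕ c)

-- Modulo 2, (1 + x) ^ (j + K) ≡ (1 + x) ^ j (1 + x ^ K) when K is a power of 2. Hence the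
-- first K rows of U are K-periodic in the column index, and row K + i of column j + K minus row K + i
-- of column j equals ± U i j, with a sign depending on j only. For n = K + L with 0 < L ≤ K,
-- subtracting column c from column K + c (c < L) therefore turns U_m(n) into a block lower triangular
-- matrix with diagonal blocks U_m(K) and U_m(L) with columns multiplied by signs, so
-- det U_m(n) = ± det U_m(K) · det U_m(L), and induction on k over n ≤ 2 ^ k concludes.

module Submission where

open import Defs
open import Data.Empty using (⊥-elim)
open import Data.Fin as Fin using (Fin; zero; suc; toℕ; punchIn; punchOut; _↑ˡ_; _↑ʳ_)
import Data.Fin.Properties as Finₚ
open import Data.Integer using (ℤ; +_; -_)
import Data.Integer.Properties as ℤₚ
open import Data.Nat as ℕ using (ℕ; zero; suc; z≤n; s≤s)
import Data.Nat.Properties as ℕₚ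
open import Data.Product using (_×_; _,_)
open import Data.Sum using (_⊎_; inj₁; inj₂; [_,_]′)
open import Function using (_∘_)
open import Relation.Binary.PropositionalEquality
open import Relation.Nullary using (yes; no)

module Determinant where

  open import Algebra.Properties.CommutativeMonoid.Sum ℤₚ.*-1-commutativeMonoid public
    using () renaming (sum to product; sum-remove to product-removeAt)
  open import Data.Integer using (_+_; _*_; _-_; -[1+_])
  open import Data.Integer.Tactic.RingSolver using (solve-∀)
  open import Relation.Binary.Definitions using (tri<; tri≈; tri>)
  open Finₚ using (punchIn-punchOut; punchInᵢ≢i)

  Mat : ℕ → Set
  Mat n = Fin n → Fin n → ℤ

  minor : ∀ {n} → Fin (suc n) → Mat (suc n) → Mat n
  minor j M r c = M (suc r) (punchIn j c)

  signedSum-cong : ∀ k {f g : Fin k → ℤ} → (∀ j → f j ≡ g j) → signedSum k f ≡ signedSum k g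
  signedSum-cong zero    eq = refl
  signedSum-cong (suc k) eq = cong₂ _-_ (eq zero) (signedSum-cong k (λ j → eq (suc j)))

  signedSum-zero : ∀ k (f : Fin k → ℤ) → (∀ j → f j ≡ + 0) → signedSum k f ≡ + 0
  signedSum-zero zero    f eq = refl
  signedSum-zero (suc k) f eq rewrite eq zero | signedSum-zero k (λ j → f (suc j)) (λ j → eq (suc j)) = refl

  signedSum-linear : ∀ k (l : ℤ) (f g : Fin k → ℤ) →
    signedSum k (λ j → f j + l * g j) ≡ signedSum k f + l * signedSum k g
  signedSum-linear zero    l f g = sym (trans (ℤₚ.+-identityˡ _) (ℤₚ.*-zeroʳ l))
  signedSum-linear (suc k) l f g
    rewrite signedSum-linear k l (λ j → f (suc j)) (λ j → g (suc j)) =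
    lemma l (f zero) (g zero) (signedSum k (λ j → f (suc j))) (signedSum k (λ j → g (suc j)))
    where
    lemma : ∀ l x y u v → (x + l * y) - (u + l * v) ≡ (x - u) + l * (y - v)
    lemma = solve-∀

  signedSum-*ˡ : ∀ k (x : ℤ) (f : Fin k → ℤ) → signedSum k (λ j → x * f j) ≡ x * signedSum k f
  signedSum-*ˡ zero    x f = sym (ℤₚ.*-zeroʳ x)
  signedSum-*ˡ (suc k) x f rewrite signedSum-*ˡ k x (λ j → f (suc j)) =
    lemma x (f zero) (signedSum k (λ j → f (suc j)))
    where
    lemma : ∀ x y u → x * y - x * u ≡ x * (y - u)
    lemma = solve-∀

  signedSum-neg : ∀ k (f g : Fin k → ℤ) → (∀ j → g j ≡ - f j) → signedSum k g ≡ - signedSum k f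
  signedSum-neg k f g eq =
    trans (signedSum-cong k (λ j → trans (eq j) (sym (ℤₚ.-1*i≡-i (f j)))))
          (trans (signedSum-*ˡ k (- + 1) f) (ℤₚ.-1*i≡-i _))

  det-cong : ∀ n {M N : Mat n} → (∀ r c → M r c ≡ N r c) → det n M ≡ det n N
  det-cong zero    eq = refl
  det-cong (suc n) eq =
    signedSum-cong (suc n) (λ j → cong₂ _*_ (eq zero j) (det-cong n (λ r c → eq (suc r) (punchIn j c))))

  Adjacent : ∀ {n} → Fin n → Fin n → Set
  Adjacent a b = toℕ b ≡ suc (toℕ a)

  signedSum-swapAdjacent : ∀ k (f g : Fin k → ℤ) {a b : Fin k} → Adjacent a b →
    (∀ j → j ≢ a → j ≢ b → g j ≡ - f j) → g a ≡ f b → g b ≡ f a →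
    signedSum k g ≡ - signedSum k f
  signedSum-swapAdjacent (suc (suc k)) f g {zero} {suc zero} _ others ga gb
    rewrite ga | gb
          | signedSum-neg k (λ j → f (suc (suc j))) (λ j → g (suc (suc j)))
              (λ j → others (suc (suc j)) (λ ()) (λ ())) =
    lemma (f zero) (f (suc zero)) (signedSum k (λ j → f (suc (suc j))))
    where
    lemma : ∀ x y u → y - (x - - u) ≡ - (x - (y - u))
    lemma = solve-∀
  signedSum-swapAdjacent (suc k) f g {suc a} {suc b} ab others ga gb
    rewrite others zero (λ ()) (λ ())
          | signedSum-swapAdjacent k (λ j → f (suc j)) (λ j → g (suc j)) (ℕₚ.suc-injective ab)
              (λ j j≢a j≢b → others (suc j) (j≢a ∘ Finₚ.suc-injective) (j≢b ∘ Finₚ.suc-injective)) ga gb =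
    sym (ℤₚ.neg-distrib-+ (f zero) _)
  signedSum-swapAdjacent (suc (suc k)) f g {zero} {suc (suc b)} ()
  signedSum-swapAdjacent (suc k)       f g {suc a} {zero}       ()
  signedSum-swapAdjacent (suc k)       f g {zero}  {zero}       ()

  punchIn-adjacent : ∀ {n} {a b : Fin (suc n)} → Adjacent a b → ∀ c →
    punchIn a c ≡ punchIn b c ⊎ (punchIn a c ≡ b × punchIn b c ≡ a)
  punchIn-adjacent {a = zero}  {suc zero} _  zero    = inj₂ (refl , refl)
  punchIn-adjacent {a = zero}  {suc zero} _  (suc c) = inj₁ refl
  punchIn-adjacent {a = suc a} {suc b}    _  zero    = inj₁ refl
  punchIn-adjacent {a = suc a} {suc b}    ab (suc c) with punchIn-adjacent (ℕₚ.suc-injective ab) c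
  ... | inj₁ eq          = inj₁ (cong suc eq)
  ... | inj₂ (ea , eb)   = inj₂ (cong suc ea , cong suc eb)
  punchIn-adjacent {a = zero}  {suc (suc b)} ()
  punchIn-adjacent {a = suc a} {zero}        ()
  punchIn-adjacent {a = zero}  {zero}        ()

  punchOut-adjacent : ∀ {n} {j a b : Fin (suc n)} (j≢a : j ≢ a) (j≢b : j ≢ b) →
    Adjacent a b → Adjacent (punchOut j≢a) (punchOut j≢b)
  punchOut-adjacent {_}           {zero}        {zero}  {_}        j≢a _   _  = ⊥-elim (j≢a refl)
  punchOut-adjacent {_}           {zero}        {suc a} {suc b}    _   _   ab = ℕₚ.suc-injective ab
  punchOut-adjacent {suc _}       {suc zero}    {zero}  {suc zero} _   j≢b _  = ⊥-elim (j≢b refl)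
  punchOut-adjacent {suc (suc _)} {suc (suc j)} {zero}  {suc zero} _   _   _  = refl
  punchOut-adjacent {suc _}       {suc j}       {suc a} {suc b}    j≢a j≢b ab =
    cong suc (punchOut-adjacent (j≢a ∘ cong suc) (j≢b ∘ cong suc) (ℕₚ.suc-injective ab))
  punchOut-adjacent {_}     {zero}  {suc a} {zero}        _ _ ()
  punchOut-adjacent {suc _} {suc j} {zero}  {zero}        _ _ ()
  punchOut-adjacent {suc _} {suc j} {zero}  {suc (suc b)} _ _ ()
  punchOut-adjacent {suc _} {suc j} {suc a} {zero}        _ _ ()

  record SwapsColumns {n} (a b : Fin n) (M N : Mat n) : Set where
    field
      others : ∀ r c → c ≢ a → c ≢ b → N r c ≡ M r c
      at-a   : ∀ r → N r a ≡ M r b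
      at-b   : ∀ r → N r b ≡ M r a

  swapsColumns-sym : ∀ {n} {a b : Fin n} {M N : Mat n} → SwapsColumns a b M N → SwapsColumns a b N M
  swapsColumns-sym s = record
    { others = λ r c c≢a c≢b → sym (others r c c≢a c≢b)
    ; at-a   = λ r → sym (at-b r)
    ; at-b   = λ r → sym (at-a r)
    }
    where open SwapsColumns s

  swapsColumns-minor : ∀ {n} {a b j : Fin (suc n)} {M N : Mat (suc n)} → SwapsColumns a b M N →
    (j≢a : j ≢ a) (j≢b : j ≢ b) → SwapsColumns (punchOut j≢a) (punchOut j≢b) (minor j M) (minor j N)
  swapsColumns-minor {j = j} {M} {N} s j≢a j≢b = record
    { others = λ r c c≢a c≢b → others (suc r) (punchIn j c)
                 (c≢a ∘ punchIn-injective′ j≢a) (c≢b ∘ punchIn-injective′ j≢b)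
    ; at-a   = λ r → trans (cong (N (suc r)) (punchIn-punchOut j≢a))
                       (trans (at-a (suc r)) (cong (M (suc r)) (sym (punchIn-punchOut j≢b))))
    ; at-b   = λ r → trans (cong (N (suc r)) (punchIn-punchOut j≢b))
                       (trans (at-b (suc r)) (cong (M (suc r)) (sym (punchIn-punchOut j≢a))))
    }
    where
    open SwapsColumns s
    punchIn-injective′ : ∀ {a c} (j≢a : j ≢ a) → punchIn j c ≡ a → c ≡ punchOut j≢a
    punchIn-injective′ j≢a e = Finₚ.punchIn-injective j _ _ (trans e (sym (punchIn-punchOut j≢a)))

  swapsColumns-minor-at : ∀ {n} {a b : Fin (suc n)} {M N : Mat (suc n)} → Adjacent a b →
    SwapsColumns a b M N → ∀ r c → minor a N r c ≡ minor b M r c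
  swapsColumns-minor-at {a = a} {b} {M} {N} ab s r c with punchIn-adjacent ab c
  ... | inj₁ eq =
    trans (others (suc r) (punchIn a c) (punchInᵢ≢i a c) (λ e → punchInᵢ≢i b c (trans (sym eq) e)))
          (cong (M (suc r)) eq)
    where open SwapsColumns s
  ... | inj₂ (ea , eb) = trans (cong (N (suc r)) ea) (trans (at-b (suc r)) (cong (M (suc r)) (sym eb)))
    where open SwapsColumns s

  det-swapAdjacent : ∀ n {a b : Fin n} {M N : Mat n} → Adjacent a b → SwapsColumns a b M N →
    det n N ≡ - det n M
  det-swapAdjacent (suc n) {a} {b} {M} {N} ab s =
    signedSum-swapAdjacent (suc n) (λ j → M zero j * det n (minor j M)) (λ j → N zero j * det n (minor j N)) ab
      term-other
      (cong₂ _*_ (at-a zero) (det-cong n (swapsColumns-minor-at ab s)))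
      (cong₂ _*_ (at-b zero) (sym (det-cong n (swapsColumns-minor-at ab (swapsColumns-sym s)))))
    where
    open SwapsColumns s
    term-other : ∀ j → j ≢ a → j ≢ b → N zero j * det n (minor j N) ≡ - (M zero j * det n (minor j M))
    term-other j j≢a j≢b = begin
      N zero j * det n (minor j N)
        ≡⟨ cong₂ _*_ (others zero j j≢a j≢b)
                     (det-swapAdjacent n (punchOut-adjacent j≢a j≢b ab) (swapsColumns-minor s j≢a j≢b)) ⟩
      M zero j * - det n (minor j M)     ≡⟨ ℤₚ.neg-distribʳ-* (M zero j) _ ⟨
      - (M zero j * det n (minor j M))   ∎
      where open ≡-Reasoning

  replaceColumn : ∀ {n} → Fin n → (Fin n → ℤ) → Mat n → Mat n
  replaceColumn t v M r c with c Fin.≟ t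
  ... | yes _ = v r
  ... | no  _ = M r c

  replaceColumn-at : ∀ {n} (t : Fin n) v M r → replaceColumn t v M r t ≡ v r
  replaceColumn-at t v M r with t Fin.≟ t
  ... | yes _  = refl
  ... | no t≢t = ⊥-elim (t≢t refl)

  replaceColumn-other : ∀ {n} {t c : Fin n} v M r → c ≢ t → replaceColumn t v M r c ≡ M r c
  replaceColumn-other {t = t} {c} v M r c≢t with c Fin.≟ t
  ... | yes c≡t = ⊥-elim (c≢t c≡t)
  ... | no  _   = refl

  swapColumns : ∀ {n} → Fin n → Fin n → Mat n → Mat n
  swapColumns a b M = replaceColumn a (λ r → M r b) (replaceColumn b (λ r → M r a) M)

  swapColumns-swaps : ∀ {n} {a b : Fin n} (M : Mat n) → a ≢ b → SwapsColumns a b M (swapColumns a b M)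
  swapColumns-swaps {a = a} {b} M a≢b = record
    { others = λ r c c≢a c≢b → trans (replaceColumn-other _ _ r c≢a) (replaceColumn-other _ M r c≢b)
    ; at-a   = replaceColumn-at a _ _
    ; at-b   = λ r → trans (replaceColumn-other _ _ r (a≢b ∘ sym)) (replaceColumn-at b _ M r)
    }

  self-negative⇒0 : ∀ {x} → x ≡ - x → x ≡ + 0
  self-negative⇒0 {+ zero}   _  = refl
  self-negative⇒0 {+ suc n}  ()
  self-negative⇒0 { -[1+ n ]} ()

  -- Swapping the right column with its left neighbour brings two equal columns closer.
  det-equalColumns-distance : ∀ d n (M : Mat n) {s t : Fin n} → toℕ t ≡ suc (d ℕ.+ toℕ s) →
    (∀ r → M r s ≡ M r t) → det n M ≡ + 0
  det-equalColumns-distance zero n M {s} {t} st eq = self-negative⇒0 (det-swapAdjacent n st swap)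
    where
    swap : SwapsColumns s t M M
    swap = record { others = λ _ _ _ _ → refl ; at-a = eq ; at-b = sym ∘ eq }
  det-equalColumns-distance (suc d) n M {s} {t} st eq = begin
    det n M             ≡⟨ ℤₚ.neg-involutive _ ⟨
    - - det n M         ≡⟨ cong -_ (det-swapAdjacent n t′t (swapColumns-swaps M t′≢t)) ⟨
    - det n N           ≡⟨ cong -_ (det-equalColumns-distance d n N (Finₚ.toℕ-fromℕ< t′<n) N-s≡t′) ⟩
    + 0                 ∎
    where
    open ≡-Reasoning
    t′<n : suc (d ℕ.+ toℕ s) ℕ.< n
    t′<n = ℕₚ.<-trans (ℕₚ.n<1+n _) (subst (ℕ._< n) st (Finₚ.toℕ<n t))
    t′ : Fin n
    t′ = Fin.fromℕ< t′<n
    t′t : Adjacent t′ t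
    t′t = trans st (cong suc (sym (Finₚ.toℕ-fromℕ< t′<n)))
    t′≢t : t′ ≢ t
    t′≢t e = ℕₚ.1+n≢n (trans (sym t′t) (cong toℕ (sym e)))
    N : Mat n
    N = swapColumns t′ t M
    s≢t′ : s ≢ t′
    s≢t′ e = ℕₚ.m≢1+n+m (toℕ s) (trans (cong toℕ e) (Finₚ.toℕ-fromℕ< t′<n))
    s≢t : s ≢ t
    s≢t e = ℕₚ.m≢1+n+m (toℕ s) (trans (cong toℕ e) st)
    N-s≡t′ : ∀ r → N r s ≡ N r t′
    N-s≡t′ r = trans (SwapsColumns.others swap r s s≢t′ s≢t) (trans (eq r) (sym (SwapsColumns.at-a swap r)))
      where swap : SwapsColumns t′ t M N
            swap = swapColumns-swaps M t′≢t

  m<n⇒n≡1+[n∸1+m]+m : ∀ {m n} → m ℕ.< n → n ≡ suc ((n ℕ.∸ suc m) ℕ.+ m)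
  m<n⇒n≡1+[n∸1+m]+m {m} m<n = trans (sym (ℕₚ.m∸n+n≡m m<n)) (ℕₚ.+-suc _ m)

  det-equalColumns : ∀ n (M : Mat n) {s t : Fin n} → s ≢ t → (∀ r → M r s ≡ M r t) → det n M ≡ + 0
  det-equalColumns n M {s} {t} s≢t eq with ℕₚ.<-cmp (toℕ s) (toℕ t)
  ... | tri< s<t _ _ = det-equalColumns-distance _ n M (m<n⇒n≡1+[n∸1+m]+m s<t) eq
  ... | tri≈ _ s≡t _ = ⊥-elim (s≢t (Finₚ.toℕ-injective s≡t))
  ... | tri> _ _ t<s = det-equalColumns-distance _ n M (m<n⇒n≡1+[n∸1+m]+m t<s) (sym ∘ eq)

  det-linearColumn : ∀ n (l : ℤ) (M₁ M₂ N : Mat n) (t : Fin n) →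
    (∀ r c → c ≢ t → N r c ≡ M₁ r c) → (∀ r c → c ≢ t → N r c ≡ M₂ r c) →
    (∀ r → N r t ≡ M₁ r t + l * M₂ r t) → det n N ≡ det n M₁ + l * det n M₂
  det-linearColumn (suc n) l M₁ M₂ N t N≡M₁ N≡M₂ N-t =
    trans (signedSum-cong (suc n) term)
          (signedSum-linear (suc n) l (λ j → M₁ zero j * det n (minor j M₁))
                                      (λ j → M₂ zero j * det n (minor j M₂)))
    where
    term : ∀ j → N zero j * det n (minor j N) ≡
                 M₁ zero j * det n (minor j M₁) + l * (M₂ zero j * det n (minor j M₂))
    term j with j Fin.≟ t
    ... | yes refl = begin
      N zero j * det n (minor j N)                          ≡⟨ cong (_* det n (minor j N)) (N-t zero) ⟩
      (M₁ zero j + l * M₂ zero j) * det n (minor j N)       ≡⟨ lemma (M₁ zero j) (M₂ zero j) l _ ⟩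
      M₁ zero j * det n (minor j N) + l * (M₂ zero j * det n (minor j N))
        ≡⟨ cong₂ (λ d₁ d₂ → M₁ zero j * d₁ + l * (M₂ zero j * d₂))
                 (minor-agrees N≡M₁) (minor-agrees N≡M₂) ⟩
      M₁ zero j * det n (minor j M₁) + l * (M₂ zero j * det n (minor j M₂)) ∎
      where
      open ≡-Reasoning
      lemma : ∀ x y l d → (x + l * y) * d ≡ x * d + l * (y * d)
      lemma = solve-∀
      minor-agrees : ∀ {M} → (∀ r c → c ≢ t → N r c ≡ M r c) → det n (minor j N) ≡ det n (minor j M)
      minor-agrees N≡M = det-cong n (λ r c → N≡M (suc r) (punchIn j c) (punchInᵢ≢i j c))
    ... | no j≢t = begin
      N zero j * det n (minor j N)                          ≡⟨ cong (N zero j *_) minor-linear ⟩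
      N zero j * (det n (minor j M₁) + l * det n (minor j M₂))
        ≡⟨ lemma (N zero j) l _ _ ⟩
      N zero j * det n (minor j M₁) + l * (N zero j * det n (minor j M₂))
        ≡⟨ cong₂ (λ x y → x * det n (minor j M₁) + l * (y * det n (minor j M₂)))
                 (N≡M₁ zero j j≢t) (N≡M₂ zero j j≢t) ⟩
      M₁ zero j * det n (minor j M₁) + l * (M₂ zero j * det n (minor j M₂)) ∎
      where
      open ≡-Reasoning
      lemma : ∀ x l u v → x * (u + l * v) ≡ x * u + l * (x * v)
      lemma = solve-∀
      p = punchIn-punchOut j≢t
      c≢punchOut : ∀ c → c ≢ punchOut j≢t → punchIn j c ≢ t
      c≢punchOut c c≢t′ e = c≢t′ (Finₚ.punchIn-injective j c _ (trans e (sym p)))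
      minor-linear : det n (minor j N) ≡ det n (minor j M₁) + l * det n (minor j M₂)
      minor-linear = det-linearColumn n l (minor j M₁) (minor j M₂) (minor j N) (punchOut j≢t)
        (λ r c c≢t′ → N≡M₁ (suc r) (punchIn j c) (c≢punchOut c c≢t′))
        (λ r c c≢t′ → N≡M₂ (suc r) (punchIn j c) (c≢punchOut c c≢t′))
        (λ r → trans (cong (N (suc r)) p)
                 (trans (N-t (suc r))
                   (cong₂ (λ c₁ c₂ → M₁ (suc r) c₁ + l * M₂ (suc r) c₂) (sym p) (sym p))))

  det-addColumn : ∀ n (l : ℤ) (M N : Mat n) {t s : Fin n} → t ≢ s →
    (∀ r c → c ≢ t → N r c ≡ M r c) → (∀ r → N r t ≡ M r t + l * M r s) → det n N ≡ det n M
  det-addColumn n l M N {t} {s} t≢s N≡M N-t = begin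
    det n N
      ≡⟨ det-linearColumn n l M M′ N t N≡M
           (λ r c c≢t → trans (N≡M r c c≢t) (sym (replaceColumn-other _ M r c≢t)))
           (λ r → trans (N-t r) (cong (λ x → M r t + l * x) (sym (replaceColumn-at t _ M r)))) ⟩
    det n M + l * det n M′ ≡⟨ cong (λ x → det n M + l * x) M′-singular ⟩
    det n M + l * + 0      ≡⟨ cong (λ x → det n M + x) (ℤₚ.*-zeroʳ l) ⟩
    det n M + + 0          ≡⟨ ℤₚ.+-identityʳ _ ⟩
    det n M                ∎
    where
    open ≡-Reasoning
    M′ : Mat n
    M′ = replaceColumn t (λ r → M r s) M
    M′-singular : det n M′ ≡ + 0
    M′-singular = det-equalColumns n M′ (t≢s ∘ sym)
      (λ r → trans (replaceColumn-other _ M r (t≢s ∘ sym)) (sym (replaceColumn-at t _ M r)))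

  det-addColumnMultiples : ∀ n (w : Fin n → ℤ) (src : Fin n → Fin n) (M : Mat n) →
    (∀ c → w (src c) ≡ + 0) →
    det n (λ r c → M r c + w c * M r (src c)) ≡ det n M
  det-addColumnMultiples n w src M w∘src≡0 =
    trans (det-cong n (λ r c → sym (partial-n r c))) (prefix n ℕₚ.≤-refl)
    where
    -- The additions are made one column at a time, to the columns of index below p in partial p;
    -- since w ∘ src vanishes, every source column keeps its original entries throughout.
    open ≡-Reasoning
    weight : ℕ → Fin n → ℤ
    weight p c with toℕ c ℕ.<? p
    ... | yes _ = w c
    ... | no  _ = + 0

    partial : ℕ → Mat n
    partial p r c = M r c + weight p c * M r (src c)

    weight-src : ∀ p c → weight p (src c) ≡ + 0
    weight-src p c with toℕ (src c) ℕ.<? p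
    ... | yes _ = w∘src≡0 c
    ... | no  _ = refl

    weight-suc : ∀ p c → toℕ c ≢ p → weight (suc p) c ≡ weight p c
    weight-suc p c c≢p with toℕ c ℕ.<? suc p | toℕ c ℕ.<? p
    ... | yes _     | yes _   = refl
    ... | no  _     | no  _   = refl
    ... | yes c<1+p | no  c≮p = ⊥-elim (c≢p (ℕₚ.≤-antisym (ℕ.s≤s⁻¹ c<1+p) (ℕₚ.≮⇒≥ c≮p)))
    ... | no  c≮1+p | yes c<p = ⊥-elim (c≮1+p (ℕₚ.m<n⇒m<1+n c<p))

    weight-at : ∀ p c → toℕ c ≡ p → weight (suc p) c ≡ w c × weight p c ≡ + 0
    weight-at p c refl with toℕ c ℕ.<? suc (toℕ c) | toℕ c ℕ.<? toℕ c
    ... | yes _ | no _      = refl , refl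
    ... | no c≮1+c | _      = ⊥-elim (c≮1+c (ℕₚ.n<1+n _))
    ... | _     | yes c<c   = ⊥-elim (ℕₚ.<-irrefl refl c<c)

    partial-unweighted : ∀ p c r → weight p c ≡ + 0 → partial p r c ≡ M r c
    partial-unweighted p c r w≡0 = begin
      M r c + weight p c * M r (src c) ≡⟨ cong (λ x → M r c + x * M r (src c)) w≡0 ⟩
      M r c + + 0 * M r (src c)        ≡⟨ ℤₚ.+-identityʳ _ ⟩
      M r c                            ∎

    partial-n : ∀ r c → partial n r c ≡ M r c + w c * M r (src c)
    partial-n r c with toℕ c ℕ.<? n
    ... | yes _   = refl
    ... | no  c≮n = ⊥-elim (c≮n (Finₚ.toℕ<n c))

    step : ∀ t → det n (partial (suc (toℕ t))) ≡ det n (partial (toℕ t))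
    step t with weight-at (toℕ t) t refl | src t Fin.≟ t
    ... | at-suc , at-p | yes src-t≡t =
      det-cong n λ r c → cong (λ x → M r c + x * M r (src c)) (weight-agrees c)
      where
      w-t≡0 : w t ≡ + 0
      w-t≡0 = trans (cong w (sym src-t≡t)) (w∘src≡0 t)
      weight-agrees : ∀ c → weight (suc (toℕ t)) c ≡ weight (toℕ t) c
      weight-agrees c with c Fin.≟ t
      ... | yes refl = trans at-suc (trans w-t≡0 (sym at-p))
      ... | no  c≢t  = weight-suc (toℕ t) c (c≢t ∘ Finₚ.toℕ-injective)
    ... | at-suc , at-p | no src-t≢t =
      det-addColumn n (w t) (partial (toℕ t)) (partial (suc (toℕ t))) (src-t≢t ∘ sym)
        (λ r c c≢t → cong (λ x → M r c + x * M r (src c)) (weight-suc (toℕ t) c (c≢t ∘ Finₚ.toℕ-injective)))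
      (λ r → begin
        M r t + weight (suc (toℕ t)) t * M r (src t)  ≡⟨ cong (λ x → M r t + x * M r (src t)) at-suc ⟩
        M r t + w t * M r (src t)
          ≡⟨ cong₂ (λ x y → x + w t * y) (partial-unweighted (toℕ t) t r at-p)
                   (partial-unweighted (toℕ t) (src t) r (weight-src (toℕ t) t)) ⟨
        partial (toℕ t) r t + w t * partial (toℕ t) r (src t) ∎)

    prefix : ∀ p → p ℕ.≤ n → det n (partial p) ≡ det n M
    prefix zero    _   = det-cong n (λ r c → ℤₚ.+-identityʳ _)
    prefix (suc p) p<n = begin
      det n (partial (suc p))                      ≡⟨ cong (λ q → det n (partial (suc q))) toℕ-t ⟨
      det n (partial (suc (toℕ t)))                ≡⟨ step t ⟩
      det n (partial (toℕ t))                      ≡⟨ cong (λ q → det n (partial q)) toℕ-t ⟩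
      det n (partial p)                            ≡⟨ prefix p (ℕₚ.<⇒≤ p<n) ⟩
      det n M                                      ∎
      where
      t = Fin.fromℕ< p<n
      toℕ-t = Finₚ.toℕ-fromℕ< p<n

  det-scaleColumns : ∀ n (ε : Fin n → ℤ) (M : Mat n) → det n (λ r c → ε c * M r c) ≡ product ε * det n M
  det-scaleColumns zero    ε M = refl
  det-scaleColumns (suc n) ε M =
    trans (signedSum-cong (suc n) term) (signedSum-*ˡ (suc n) (product ε) (λ j → M zero j * det n (minor j M)))
    where
    term : ∀ j → (ε j * M zero j) * det n (λ r c → ε (punchIn j c) * minor j M r c) ≡
                 product ε * (M zero j * det n (minor j M))
    term j = begin
      (ε j * M zero j) * det n (λ r c → ε (punchIn j c) * minor j M r c)
        ≡⟨ cong ((ε j * M zero j) *_) (det-scaleColumns n (λ c → ε (punchIn j c)) (minor j M)) ⟩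
      (ε j * M zero j) * (product (λ c → ε (punchIn j c)) * det n (minor j M))
        ≡⟨ lemma (ε j) (M zero j) _ _ ⟩
      (ε j * product (λ c → ε (punchIn j c))) * (M zero j * det n (minor j M))
        ≡⟨ cong (_* (M zero j * det n (minor j M))) (product-removeAt ε) ⟨
      product ε * (M zero j * det n (minor j M)) ∎
      where
      open ≡-Reasoning
      lemma : ∀ e x p d → (e * x) * (p * d) ≡ (e * p) * (x * d)
      lemma = solve-∀

  signedSum-vanishingTail : ∀ K L (f : Fin (K ℕ.+ L) → ℤ) → (∀ c → f (K ↑ʳ c) ≡ + 0) →
    signedSum (K ℕ.+ L) f ≡ signedSum K (λ j → f (j ↑ˡ L))
  signedSum-vanishingTail zero    L f tail≡0 = signedSum-zero L f tail≡0
  signedSum-vanishingTail (suc K) L f tail≡0 =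
    cong (λ x → f zero - x) (signedSum-vanishingTail K L (f ∘ suc) tail≡0)

  punchIn-↑ˡ : ∀ {K} L (j : Fin (suc K)) (c : Fin K) → punchIn (j ↑ˡ L) (c ↑ˡ L) ≡ punchIn j c ↑ˡ L
  punchIn-↑ˡ L zero    c       = refl
  punchIn-↑ˡ L (suc j) zero    = refl
  punchIn-↑ˡ L (suc j) (suc c) = cong suc (punchIn-↑ˡ L j c)

  punchIn-↑ʳ : ∀ K {L} (j : Fin (suc K)) (c : Fin L) → punchIn (j ↑ˡ L) (K ↑ʳ c) ≡ suc K ↑ʳ c
  punchIn-↑ʳ K       zero    c = refl
  punchIn-↑ʳ (suc K) (suc j) c = cong suc (punchIn-↑ʳ K j c)

  det-blockLowerTriangular : ∀ K L (M : Mat (K ℕ.+ L)) → (∀ r c → M (r ↑ˡ L) (K ↑ʳ c) ≡ + 0) →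
    det (K ℕ.+ L) M ≡ det K (λ r c → M (r ↑ˡ L) (c ↑ˡ L)) * det L (λ r c → M (K ↑ʳ r) (K ↑ʳ c))
  det-blockLowerTriangular zero    L M _   = sym (ℤₚ.*-identityˡ _)
  det-blockLowerTriangular (suc K) L M M₁₂≡0 = begin
    det (suc K ℕ.+ L) M
      ≡⟨ signedSum-vanishingTail (suc K) L (λ j → M zero j * det (K ℕ.+ L) (minor j M))
           (λ c → trans (cong (_* det (K ℕ.+ L) (minor (suc K ↑ʳ c) M)) (M₁₂≡0 zero c))
                        (ℤₚ.*-zeroˡ (det (K ℕ.+ L) (minor (suc K ↑ʳ c) M)))) ⟩
    signedSum (suc K) (λ j → M zero (j ↑ˡ L) * det (K ℕ.+ L) (minor (j ↑ˡ L) M))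
      ≡⟨ signedSum-cong (suc K) term ⟩
    signedSum (suc K) (λ j → D * (M zero (j ↑ˡ L) * det K (minor j A)))
      ≡⟨ signedSum-*ˡ (suc K) D (λ j → A zero j * det K (minor j A)) ⟩
    D * det (suc K) A
      ≡⟨ ℤₚ.*-comm D _ ⟩
    det (suc K) A * D ∎
    where
    open ≡-Reasoning
    A : Mat (suc K)
    A r c = M (r ↑ˡ L) (c ↑ˡ L)
    D = det L (λ r c → M (suc K ↑ʳ r) (suc K ↑ʳ c))
    minor-block : ∀ j → det (K ℕ.+ L) (minor (j ↑ˡ L) M) ≡ det K (minor j A) * D
    minor-block j = trans
      (det-blockLowerTriangular K L (minor (j ↑ˡ L) M)
        (λ r c → trans (cong (M (suc (r ↑ˡ L))) (punchIn-↑ʳ K j c)) (M₁₂≡0 (suc r) c)))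
      (cong₂ _*_ (det-cong K (λ r c → cong (M (suc (r ↑ˡ L))) (punchIn-↑ˡ L j c)))
                 (det-cong L (λ r c → cong (M (suc (K ↑ʳ r))) (punchIn-↑ʳ K j c))))
    term : ∀ j → M zero (j ↑ˡ L) * det (K ℕ.+ L) (minor (j ↑ˡ L) M) ≡
                 D * (M zero (j ↑ˡ L) * det K (minor j A))
    term j = trans (cong (M zero (j ↑ˡ L) *_) (minor-block j)) (lemma (M zero (j ↑ˡ L)) _ D)
      where
      lemma : ∀ x a d → x * (a * d) ≡ d * (x * a)
      lemma = solve-∀

module BinomialParity where

  open import Data.Nat
  open import Data.Nat.Combinatorics using (_C_; nCk+nC[k+1]≡[n+1]C[k+1]; k>n⇒nCk≡0)
  open import Data.Nat.DivMod using (_%_; %-distribˡ-+; [m+kn]%n≡m%n)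
  open import Data.Nat.Induction using (<-rec)
  open import Data.Nat.Properties
  import Data.Nat.Tactic.RingSolver as ℕ-Solver
  open import Level using (0ℓ)
  open import Relation.Binary.Bundles using (Setoid)

  infix 4 _≡₂_

  -- A record rather than a synonym for a % 2 ≡ b % 2, so that a and b can be inferred.
  record _≡₂_ (a b : ℕ) : Set where
    constructor mod₂
    field ≡-mod₂ : a % 2 ≡ b % 2
  open _≡₂_ public

  ≡₂-setoid : Setoid 0ℓ 0ℓ
  ≡₂-setoid = record
    { Carrier       = ℕ
    ; _≈_           = _≡₂_
    ; isEquivalence = record
      { refl  = mod₂ refl
      ; sym   = λ (mod₂ e) → mod₂ (sym e)
      ; trans = λ (mod₂ e) (mod₂ f) → mod₂ (trans e f)
      }
    }

  ≡⇒≡₂ : ∀ {a b} → a ≡ b → a ≡₂ b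
  ≡⇒≡₂ e = mod₂ (cong (_% 2) e)

  ≡₂-+ : ∀ {a a′ b b′} → a ≡₂ a′ → b ≡₂ b′ → a + b ≡₂ a′ + b′
  ≡₂-+ {a} {a′} {b} {b′} (mod₂ a≡a′) (mod₂ b≡b′) = mod₂ (begin
    (a + b) % 2                  ≡⟨ %-distribˡ-+ a b 2 ⟩
    (a % 2 + b % 2) % 2          ≡⟨ cong₂ (λ x y → (x + y) % 2) a≡a′ b≡b′ ⟩
    (a′ % 2 + b′ % 2) % 2        ≡⟨ %-distribˡ-+ a′ b′ 2 ⟨
    (a′ + b′) % 2                ∎)
    where open ≡-Reasoning

  +-double-≡₂ : ∀ a b → a + (b + b) ≡₂ a
  +-double-≡₂ a b = mod₂ (trans (cong (λ x → (a + x) % 2) b+b≡b*2) ([m+kn]%n≡m%n a b 2))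
    where
    b+b≡b*2 : b + b ≡ b * 2
    b+b≡b*2 = trans (cong (λ x → b + x) (sym (+-identityʳ b))) (*-comm 2 b)

  open Setoid ≡₂-setoid public using () renaming (sym to ≡₂-sym; trans to ≡₂-trans)
  open import Relation.Binary.Reasoning.Setoid ≡₂-setoid

  -- The parity form of (1 + x) ^ (j + K) ≡ (1 + x) ^ j * (1 + x ^ K) (mod 2), valid for K a power of 2.
  record BinomialShift (K : ℕ) : Set where
    field
      shift-high : ∀ j i → (j + K) C (i + K) ≡₂ j C (i + K) + j C i
      shift-low  : ∀ j i → i < K → (j + K) C i ≡₂ j C i
  open BinomialShift public

  binomialShift-1 : BinomialShift 1
  shift-high binomialShift-1 j i rewrite +-comm j 1 | +-comm i 1 =
    ≡⇒≡₂ (trans (sym (nCk+nC[k+1]≡[n+1]C[k+1] j i)) (+-comm (j C i) (j C suc i)))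
  shift-low binomialShift-1 j zero    _ = mod₂ refl
  shift-low binomialShift-1 j (suc i) (s≤s ())

  binomialShift-double : ∀ {K} → BinomialShift K → BinomialShift (K + K)
  shift-high (binomialShift-double {K} s) j i rewrite sym (+-assoc j K K) | sym (+-assoc i K K) = begin
    (j + K + K) C (i + K + K)
      ≈⟨ shift-high s (j + K) (i + K) ⟩
    (j + K) C (i + K + K) + (j + K) C (i + K)
      ≈⟨ ≡₂-+ (shift-high s j (i + K)) (shift-high s j i) ⟩
    (j C (i + K + K) + j C (i + K)) + (j C (i + K) + j C i)
      ≡⟨ rearrange (j C (i + K + K)) (j C (i + K)) (j C i) ⟩
    (j C (i + K + K) + j C i) + (j C (i + K) + j C (i + K))
      ≈⟨ +-double-≡₂ _ (j C (i + K)) ⟩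
    j C (i + K + K) + j C i ∎
    where
    rearrange : ∀ a x b → (a + x) + (x + b) ≡ (a + b) + (x + x)
    rearrange = ℕ-Solver.solve-∀
  shift-low (binomialShift-double {K} s) j i i<K+K with i <? K
  ... | yes i<K rewrite sym (+-assoc j K K) = ≡₂-trans (shift-low s (j + K) i i<K) (shift-low s j i i<K)
  ... | no  i≮K rewrite sym (+-assoc j K K) | sym (m∸n+n≡m (≮⇒≥ i≮K)) = begin
    (j + K + K) C (i′ + K)                   ≈⟨ shift-high s (j + K) i′ ⟩
    (j + K) C (i′ + K) + (j + K) C i′        ≈⟨ ≡₂-+ (shift-high s j i′) (shift-low s j i′ i′<K) ⟩
    (j C (i′ + K) + j C i′) + j C i′         ≡⟨ +-assoc (j C (i′ + K)) (j C i′) (j C i′) ⟩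
    j C (i′ + K) + (j C i′ + j C i′)         ≈⟨ +-double-≡₂ _ (j C i′) ⟩
    j C (i′ + K)                             ∎
    where
    i′ = i ∸ K
    i′<K : i′ < K
    i′<K = +-cancelʳ-< K i′ K i<K+K

  binomialShift : ∀ k → BinomialShift (2 ^ k)
  binomialShift zero    = binomialShift-1
  binomialShift (suc k) = subst BinomialShift (cong (λ x → 2 ^ k + x) (sym (+-identityʳ (2 ^ k))))
                            (binomialShift-double (binomialShift k))

  UpperVanishes UpperRepeats : ℕ → ℕ → Set
  UpperVanishes K j = ∀ i → i < K → j C (i + K) ≡₂ 0
  UpperRepeats  K j = ∀ i → i < K → j C (i + K) ≡₂ j C i

  module _ {K} (s : BinomialShift K) where

    shift-vanishes : ∀ {j} → UpperVanishes K j → ∀ i → i < K → (j + K) C (i + K) ≡₂ j C i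
    shift-vanishes {j} v i i<K = ≡₂-trans (shift-high s j i) (≡₂-+ (v i i<K) (mod₂ refl))

    shift-repeats : ∀ {j} → UpperRepeats K j → ∀ i → i < K → (j + K) C (i + K) ≡₂ 0
    shift-repeats {j} r i i<K =
      ≡₂-trans (shift-high s j i) (≡₂-trans (≡₂-+ (r i i<K) (mod₂ refl)) (+-double-≡₂ 0 (j C i)))

  -- The two cases occur according as ⌊j / K⌋ is even or odd.
  upper-dichotomy : ∀ {K} → BinomialShift K → ∀ j → UpperVanishes K j ⊎ UpperRepeats K j
  upper-dichotomy {zero}      s j = inj₁ (λ _ ())
  upper-dichotomy {K@(suc _)} s   = <-rec _ step
    where
    shift : ∀ {j} → UpperVanishes K j ⊎ UpperRepeats K j → UpperVanishes K (j + K) ⊎ UpperRepeats K (j + K)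
    shift (inj₁ v) = inj₂ (λ i i<K → ≡₂-trans (shift-vanishes s v i i<K) (≡₂-sym (shift-low s _ i i<K)))
    shift (inj₂ r) = inj₁ (shift-repeats s r)
    step : ∀ j → (∀ {j′} → j′ < j → UpperVanishes K j′ ⊎ UpperRepeats K j′) →
           UpperVanishes K j ⊎ UpperRepeats K j
    step j ih with j <? K
    ... | yes j<K = inj₁ (λ i _ → ≡⇒≡₂ (k>n⇒nCk≡0 (<-≤-trans j<K (m≤n+m K i))))
    ... | no  j≮K = subst (λ x → UpperVanishes K x ⊎ UpperRepeats K x) (m∸n+n≡m (≮⇒≥ j≮K))
                      (shift (ih (∸-monoʳ-< z<s (≮⇒≥ j≮K))))

module UnitMinors where

  open Determinant
  open BinomialParity
  open import Data.Integer using (_+_; _*_; _-_)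
  open import Data.Integer.Tactic.RingSolver using (solve-∀)
  open import Data.Nat using (_^_)

  IsUnit : ℤ → Set
  IsUnit x = x ≡ + 1 ⊎ x ≡ - + 1

  isUnit-* : ∀ {x y} → IsUnit x → IsUnit y → IsUnit (x * y)
  isUnit-* (inj₁ refl) (inj₁ refl) = inj₁ refl
  isUnit-* (inj₁ refl) (inj₂ refl) = inj₂ refl
  isUnit-* (inj₂ refl) (inj₁ refl) = inj₂ refl
  isUnit-* (inj₂ refl) (inj₂ refl) = inj₁ refl

  isUnit-product : ∀ {n} (ε : Fin n → ℤ) → (∀ c → IsUnit (ε c)) → IsUnit (product ε)
  isUnit-product {zero}  ε units = inj₁ refl
  isUnit-product {suc n} ε units = isUnit-* (units zero) (isUnit-product (ε ∘ suc) (units ∘ suc))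

  columnSign : ∀ {K} → BinomialShift K → ℕ → ℤ
  columnSign s j with upper-dichotomy s j
  ... | inj₁ _ = + 1
  ... | inj₂ _ = - + 1

  columnSign-isUnit : ∀ {K} (s : BinomialShift K) j → IsUnit (columnSign s j)
  columnSign-isUnit s j with upper-dichotomy s j
  ... | inj₁ _ = inj₁ refl
  ... | inj₂ _ = inj₂ refl

  U-periodic : ∀ {K} → BinomialShift K → ∀ {i} j → i ℕ.< K → U i (j ℕ.+ K) ≡ U i j
  U-periodic s {i} j i<K = cong +_ (≡-mod₂ (shift-low s j i i<K))

  U-shiftDifference : ∀ {K} (s : BinomialShift K) {i} j → i ℕ.< K →
    U (K ℕ.+ i) (j ℕ.+ K) - U (K ℕ.+ i) j ≡ columnSign s j * U i j
  U-shiftDifference {K} s {i} j i<K with upper-dichotomy s j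
  ... | inj₁ v rewrite ℕₚ.+-comm K i | ≡-mod₂ (shift-vanishes s v i i<K) | ≡-mod₂ (v i i<K) = lemma _
    where
    lemma : ∀ x → x - + 0 ≡ + 1 * x
    lemma = solve-∀
  ... | inj₂ r rewrite ℕₚ.+-comm K i | ≡-mod₂ (shift-repeats s r i i<K) | ≡-mod₂ (r i i<K) = lemma _
    where
    lemma : ∀ x → + 0 - x ≡ - + 1 * x
    lemma = solve-∀

  -- Subtracting column c from column K + c for every c < L makes U_m(K + L) block lower triangular,
  -- by U-periodic above the diagonal blocks and U-shiftDifference below them.
  module _ (k L m : ℕ) (L≤K : L ℕ.≤ 2 ^ k) where

    private
      K = 2 ^ k
      s = binomialShift k
      A = Usub m (K ℕ.+ L)

    columnSigns : Fin L → ℤ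
    columnSigns c = columnSign s (m ℕ.+ toℕ c)

    private
      sourceColumn : Fin (K ℕ.+ L) → Fin (K ℕ.+ L)
      sourceColumn c = [ _↑ˡ L , (λ c′ → Fin.inject≤ c′ L≤K ↑ˡ L) ]′ (Fin.splitAt K c)

      weight : Fin (K ℕ.+ L) → ℤ
      weight c = [ (λ _ → + 0) , (λ _ → - + 1) ]′ (Fin.splitAt K c)

      weight-sourceColumn : ∀ c → weight (sourceColumn c) ≡ + 0
      weight-sourceColumn c with Fin.splitAt K c
      ... | inj₁ c′ rewrite Finₚ.splitAt-↑ˡ K c′ L = refl
      ... | inj₂ c′ rewrite Finₚ.splitAt-↑ˡ K (Fin.inject≤ c′ L≤K) L = refl

      R : Mat (K ℕ.+ L)
      R r c = A r c + weight c * A r (sourceColumn c)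

      m+[K+c]≡[m+c]+K : ∀ c → m ℕ.+ (K ℕ.+ c) ≡ (m ℕ.+ c) ℕ.+ K
      m+[K+c]≡[m+c]+K c = trans (cong (m ℕ.+_) (ℕₚ.+-comm K c)) (sym (ℕₚ.+-assoc m c K))

      R-right : ∀ r c → R r (K ↑ʳ c) ≡ U (toℕ r) ((m ℕ.+ toℕ c) ℕ.+ K) - U (toℕ r) (m ℕ.+ toℕ c)
      R-right r c
        rewrite Finₚ.splitAt-↑ʳ K L c | Finₚ.toℕ-↑ʳ K c | Finₚ.toℕ-↑ˡ (Fin.inject≤ c L≤K) L
              | Finₚ.toℕ-inject≤ c L≤K | m+[K+c]≡[m+c]+K (toℕ c) =
        cong (λ x → U (toℕ r) ((m ℕ.+ toℕ c) ℕ.+ K) + x) (ℤₚ.-1*i≡-i (U (toℕ r) (m ℕ.+ toℕ c)))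

      R-upperRight : ∀ r c → R (r ↑ˡ L) (K ↑ʳ c) ≡ + 0
      R-upperRight r c = begin
        R (r ↑ˡ L) (K ↑ʳ c)                             ≡⟨ R-right (r ↑ˡ L) c ⟩
        U i ((m ℕ.+ toℕ c) ℕ.+ K) - U i (m ℕ.+ toℕ c)   ≡⟨ cong (_- U i (m ℕ.+ toℕ c)) (U-periodic s _ i<K) ⟩
        U i (m ℕ.+ toℕ c) - U i (m ℕ.+ toℕ c)           ≡⟨ ℤₚ.+-inverseʳ (U i (m ℕ.+ toℕ c)) ⟩
        + 0                                             ∎
        where
        open ≡-Reasoning
        i = toℕ (r ↑ˡ L)
        i<K : i ℕ.< K
        i<K = subst (ℕ._< K) (sym (Finₚ.toℕ-↑ˡ r L)) (Finₚ.toℕ<n r)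

      R-upperLeft : ∀ r c → R (r ↑ˡ L) (c ↑ˡ L) ≡ Usub m K r c
      R-upperLeft r c rewrite Finₚ.splitAt-↑ˡ K c L | Finₚ.toℕ-↑ˡ r L | Finₚ.toℕ-↑ˡ c L = ℤₚ.+-identityʳ _

      R-lowerRight : ∀ r c → R (K ↑ʳ r) (K ↑ʳ c) ≡ columnSigns c * Usub m L r c
      R-lowerRight r c = begin
        R (K ↑ʳ r) (K ↑ʳ c)
          ≡⟨ R-right (K ↑ʳ r) c ⟩
        U (toℕ (K ↑ʳ r)) ((m ℕ.+ toℕ c) ℕ.+ K) - U (toℕ (K ↑ʳ r)) (m ℕ.+ toℕ c)
          ≡⟨ cong (λ i → U i ((m ℕ.+ toℕ c) ℕ.+ K) - U i (m ℕ.+ toℕ c)) (Finₚ.toℕ-↑ʳ K r) ⟩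
        U (K ℕ.+ toℕ r) ((m ℕ.+ toℕ c) ℕ.+ K) - U (K ℕ.+ toℕ r) (m ℕ.+ toℕ c)
          ≡⟨ U-shiftDifference s (m ℕ.+ toℕ c) (ℕₚ.<-≤-trans (Finₚ.toℕ<n r) L≤K) ⟩
        columnSigns c * Usub m L r c ∎
        where open ≡-Reasoning

    det-Usub-split :
      det (K ℕ.+ L) (Usub m (K ℕ.+ L)) ≡ det K (Usub m K) * (product columnSigns * det L (Usub m L))
    det-Usub-split = begin
      det (K ℕ.+ L) A
        ≡⟨ det-addColumnMultiples (K ℕ.+ L) weight sourceColumn A weight-sourceColumn ⟨
      det (K ℕ.+ L) R
        ≡⟨ det-blockLowerTriangular K L R R-upperRight ⟩
      det K (λ r c → R (r ↑ˡ L) (c ↑ˡ L)) * det L (λ r c → R (K ↑ʳ r) (K ↑ʳ c))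
        ≡⟨ cong₂ _*_ (det-cong K R-upperLeft) (det-cong L R-lowerRight) ⟩
      det K (Usub m K) * det L (λ r c → columnSigns c * Usub m L r c)
        ≡⟨ cong (det K (Usub m K) *_) (det-scaleColumns L columnSigns (Usub m L)) ⟩
      det K (Usub m K) * (product columnSigns * det L (Usub m L)) ∎
      where open ≡-Reasoning

    det-Usub-split-isUnit : IsUnit (det K (Usub m K)) → IsUnit (det L (Usub m L)) →
      IsUnit (det (K ℕ.+ L) (Usub m (K ℕ.+ L)))
    det-Usub-split-isUnit unit-K unit-L = subst IsUnit (sym det-Usub-split)
      (isUnit-* unit-K (isUnit-* (isUnit-product columnSigns (columnSign-isUnit s ∘ (m ℕ.+_) ∘ toℕ)) unit-L))

  det-Usub-isUnit : ∀ k m n → n ℕ.≤ 2 ^ k → IsUnit (det n (Usub m n))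
  det-Usub-isUnit zero    m zero          _ = inj₁ refl
  det-Usub-isUnit zero    m (suc zero)    _ = inj₁ refl
  det-Usub-isUnit zero    m (suc (suc n)) (s≤s ())
  det-Usub-isUnit (suc k) m n n≤2K with n ℕ.≤? 2 ^ k
  ... | yes n≤K = det-Usub-isUnit k m n n≤K
  ... | no  n≰K = subst (λ n → IsUnit (det n (Usub m n))) (ℕₚ.m+[n∸m]≡n K≤n)
    (det-Usub-split-isUnit k L m L≤K (det-Usub-isUnit k m K ℕₚ.≤-refl) (det-Usub-isUnit k m L L≤K))
    where
    K = 2 ^ k
    K≤n = ℕₚ.<⇒≤ (ℕₚ.≰⇒> n≰K)
    L = n ℕ.∸ K
    L≤K : L ℕ.≤ K
    L≤K = subst (L ℕ.≤_) (ℕₚ.+-identityʳ K) (ℕₚ.m≤n+o⇒m∸n≤o n K n≤2K)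

  n<2^n : ∀ n → n ℕ.< 2 ^ n
  n<2^n zero    = s≤s z≤n
  n<2^n (suc n) =
    ℕₚ.+-mono-≤ (ℕₚ.m^n>0 2 n) (subst (suc n ℕ.≤_) (sym (ℕₚ.+-identityʳ (2 ^ n))) (n<2^n n))

open UnitMinors using (det-Usub-isUnit; n<2^n)

theorem1 : (n m : ℕ) → (det n (Usub m n) ≡ + 1) ⊎ (det n (Usub m n) ≡ - (+ 1))
theorem1 n m = det-Usub-isUnit n m n (ℕₚ.<⇒≤ (n<2^n n))
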